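{- For $t\in\mathbb{Z}$ let $E_t$ and $F_t$ be the Weierstrass equations $E_t: y^2-x^2y=x^5+16t\,x^4+(16+8t)\,x^3+(8+t)\,x^2+x$ and $F_t: y^2+(-x^2-x)y=x^5+(-1+t)\,x^4+(-2-2t)\,x^3+(2+t)\,x^2-x$, and let $f(t)=256t^4-2064t^3+4192t^2+384t-1051$ and $g(t)=256t^4+768t^3-800t^2-2064t-6343$. Then $f(t),g(t)\in\mathbb{Z}[t]$ are irreducible of degree $4$, and for $t_0\in\mathbb{Z}$ and a square-free odd integer $m$, $|\Delta_{E_{t_0}}|=m$ if and only if $|f(t_0)|=m$, and $|\Delta_{F_{t_0}}|=m$ if and only if $|g(t_0)|=m$. In particular, for an odd prime $p$, $\Delta_{E_{t_0}}=\pm p$ if and only if $f(t_0)=\pm p$, and $\Delta_{F_{t_0}}=\pm p$ if and only if $g(t_0)=\pm p$.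
   Context: For a Weierstrass equation $E: y^2+Q(x)y=P(x)$ of a genus $2$ curve over $\mathbb{Q}$, its discriminant is $\Delta_E=2^{ -12}\operatorname{disc}(4P(x)+Q(x)^2)$. -}

module Defs where

open import Data.Nat as ℕ using (ℕ; zero; suc; _∸_; _≤ᵇ_; _<ᵇ_; ⌊_/2⌋; NonZero)
open import Data.Integer as ℤ using (ℤ; +_; -[1+_]; _+_; _*_; -_; _^_)
open import Data.Integer.Divisibility using (_∣_)
open import Data.Rational as ℚ using (ℚ; _/_)
open import Data.Fin using (Fin; toℕ; punchIn) renaming (zero to fzero; suc to fsuc)
open import Data.List using (List; []; _∷_)
open import Data.Bool using (if_then_else_; _∧_)
open import Data.Sum using (_⊎_)
open import Data.Product using (_×_)
open import Relation.Binary.PropositionalEquality using (_≡_; _≢_)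
open import Relation.Nullary using (¬_)

-- Polynomials with integer coefficients: coefficient lists, constant
-- term first.  Two lists denote the same polynomial iff all their
-- coefficients agree (trailing zeros are irrelevant).

Poly : Set
Poly = List ℤ

coeff : Poly → ℕ → ℤ
coeff []       _       = + 0
coeff (a ∷ _)  zero    = a
coeff (_ ∷ as) (suc k) = coeff as k

_≈ₚ_ : Poly → Poly → Set
p ≈ₚ q = ∀ k → coeff p k ≡ coeff q k

infixl 6 _+ₚ_
infixl 7 _*ₚ_ _·ₚ_

_+ₚ_ : Poly → Poly → Poly
[]       +ₚ q        = q
(a ∷ p)  +ₚ []       = a ∷ p
(a ∷ p)  +ₚ (b ∷ q)  = (a + b) ∷ (p +ₚ q)

_·ₚ_ : ℤ → Poly → Poly
c ·ₚ []      = []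
c ·ₚ (a ∷ p) = (c * a) ∷ (c ·ₚ p)

_*ₚ_ : Poly → Poly → Poly
[]      *ₚ q = []
(a ∷ p) *ₚ q = (a ·ₚ q) +ₚ (+ 0 ∷ (p *ₚ q))

eval : Poly → ℤ → ℤ
eval []      t = + 0
eval (a ∷ p) t = a + t * eval p t

HasDegree : Poly → ℕ → Set
HasDegree p n = (coeff p n ≢ + 0) × (∀ k → n ℕ.< k → coeff p k ≡ + 0)

IsUnitₚ : Poly → Set
IsUnitₚ p = (p ≈ₚ (+ 1 ∷ [])) ⊎ (p ≈ₚ (-[1+ 0 ] ∷ []))

Irreducibleₚ : Poly → Set
Irreducibleₚ f =
  (¬ (f ≈ₚ [])) × (¬ IsUnitₚ f) ×
  (∀ a b → (a *ₚ b) ≈ₚ f → IsUnitₚ a ⊎ IsUnitₚ b)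

sgn : ℕ → ℤ
sgn k = (-[1+ 0 ]) ^ k

det : (n : ℕ) → (Fin n → Fin n → ℤ) → ℤ
det zero    M = + 1
det (suc n) M = sumFin (suc n) λ i →
  sgn (toℕ i) * M i fzero * det n (λ r c → M (punchIn i r) (fsuc c))
  where
  sumFin : (k : ℕ) → (Fin k → ℤ) → ℤ
  sumFin zero    f = + 0
  sumFin (suc k) f = f fzero + sumFin k (λ j → f (fsuc j))

-- Sylvester matrix and resultant of two binary forms of degrees m, n
-- given by coefficient functions (index k = coefficient of X^k Z^(deg-k))

sylEntry : (m n : ℕ) → (ℕ → ℤ) → (ℕ → ℤ) → ℕ → ℕ → ℤ
sylEntry m n a b i j =
  if i <ᵇ n
  then (if (i ≤ᵇ j) ∧ (j ∸ i ≤ᵇ m) then a (m ∸ (j ∸ i)) else + 0)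
  else (if ((i ∸ n) ≤ᵇ j) ∧ (j ∸ (i ∸ n) ≤ᵇ n) then b (n ∸ (j ∸ (i ∸ n))) else + 0)

resultant : (m n : ℕ) → (ℕ → ℤ) → (ℕ → ℤ) → ℤ
resultant m n a b = det (m ℕ.+ n) (λ r c → sylEntry m n a b (toℕ r) (toℕ c))

-- Discriminant of the binary form F(X,Z) = Σ_{k ≤ n} c_k X^k Z^(n-k)
-- of degree n (c_n may vanish):
--   disc F = (-1)^(n(n-1)/2) n^(-(n-2)) Res(∂F/∂X, ∂F/∂Z).
-- For c_n ≠ 0 this is the usual polynomial discriminant of Σ c_k x^k;
-- for c_n = 0, c_(n-1) ≠ 0 it equals c_(n-1)^2 times that of the
-- degree n-1 polynomial.

∂X : Poly → ℕ → ℤ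
∂X c j = + (suc j) * coeff c (suc j)

∂Z : ℕ → Poly → ℕ → ℤ
∂Z n c j = + (n ∸ j) * coeff c j

discForm : (n : ℕ) → .{{_ : NonZero (n ℕ.^ (n ∸ 2))}} → Poly → ℚ
discForm n c =
  (sgn ⌊ n ℕ.* (n ∸ 1) /2⌋ * resultant (n ∸ 1) (n ∸ 1) (∂X c) (∂Z n c))
    / (n ℕ.^ (n ∸ 2))

-- Genus 2 Weierstrass equations  y^2 + Q(x) y = P(x)

record Weierstrass : Set where
  constructor weq
  field
    Q : Poly
    P : Poly

-- Δ_E = 2^(-12) disc(4P + Q^2), the discriminant of 4P+Q^2 taken as a
-- binary sextic (standard genus-2 convention)
Δ : Weierstrass → ℚ
Δ (weq Q P) = discForm 6 ((+ 4 ·ₚ P) +ₚ (Q *ₚ Q)) ℚ.* (+ 1 / (2 ℕ.^ 12))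

E : ℤ → Weierstrass
E t = weq (+ 0 ∷ + 0 ∷ -[1+ 0 ] ∷ [])
          (+ 0 ∷ + 1 ∷ (+ 8 + t) ∷ (+ 16 + + 8 * t) ∷ (+ 16 * t) ∷ + 1 ∷ [])

F : ℤ → Weierstrass
F t = weq (+ 0 ∷ -[1+ 0 ] ∷ -[1+ 0 ] ∷ [])
          (+ 0 ∷ -[1+ 0 ] ∷ (+ 2 + t) ∷ (-[1+ 1 ] + -[1+ 1 ] * t) ∷ (-[1+ 0 ] + t) ∷ + 1 ∷ [])

f : Poly
f = -[1+ 1050 ] ∷ + 384 ∷ + 4192 ∷ - (+ 2064) ∷ + 256 ∷ []

g : Poly
g = -[1+ 6342 ] ∷ - (+ 2064) ∷ - (+ 800) ∷ + 768 ∷ + 256 ∷ []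

SquareFree : ℤ → Set
SquareFree m = ∀ (d : ℤ) → (d * d) ∣ m → d ∣ (+ 1)

Odd : ℤ → Set
Odd m = ¬ ((+ 2) ∣ m)

toℚ : ℤ → ℚ
toℚ z = z / 1

{-# OPTIONS --safe #-}
module Submission where

-- Both discriminants are computed once and for all as polynomials in t.  The
-- coefficients of 4P + Q² are polynomials in t, so the Sylvester determinant
-- defining Δ can be expanded over ℤ[t] and evaluated afterwards, evaluation at t
-- being a ring homomorphism.  The expansion is 6⁴·2¹²·f (resp. 6⁴·2¹²·g), hence
-- Δ_{E_t} = f(t) and Δ_{F_t} = g(t) identically, and the equivalences hold without
-- the arithmetic hypotheses on m and p.
--
-- In a factorisation of f or g, a constant factor divides the coprime constant
-- and leading coefficients, so it is ±1; a factorisation into factors of positive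
-- degree would survive reduction of the coefficients mod 3, and an exhaustive
-- search over residues finds none.

open import Defs
open import Data.Nat using (ℕ)
open import Data.Nat.Primality using (Prime)
open import Data.Integer as ℤ using (ℤ; +_; -_)
open import Data.Rational as ℚ using (ℚ)
open import Data.Product using (_×_)
open import Data.Sum using (_⊎_)
open import Function.Bundles using (_⇔_)
open import Relation.Binary.PropositionalEquality using (_≡_; _≢_)

open import Data.Nat as ℕ using (zero; suc; _<_; _∸_; _<ᵇ_; _≤ᵇ_; ⌊_/2⌋; s≤s; z≤n)
import Data.Nat.Properties as ℕ
open import Data.Nat.Coprimality using (1-coprimeTo) renaming (sym to coprime-sym)
open import Data.Integer using (-[1+_]; _+_; _*_; _-_)
import Data.Integer.Properties as ℤ
import Data.Integer.DivMod as ℤ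
open import Data.Integer.Divisibility.Signed using (_∣_; divides; _∣?_; ∣m∣n⇒∣m+n; ∣n⇒∣m*n; ∣m⇒∣m*n)
open import Data.Integer.Tactic.RingSolver using (solve-∀)
open import Data.Rational using (_/_; mkℚ)
open import Data.Rational.Unnormalised as ℚᵘ using (mkℚᵘ; *≡*)
import Data.Rational.Unnormalised.Properties as ℚᵘ
import Data.Rational.Properties as ℚ
open import Data.Fin using (Fin; toℕ; punchIn; fromℕ<) renaming (zero to fzero; suc to fsuc)
import Data.Fin.Properties as Fin
open import Data.Vec using (Vec; []; _∷_)
open import Data.List using (List; []; _∷_; _++_; replicate; length)
open import Data.Bool using (true; false; if_then_else_; _∧_)
open import Data.Product using (Σ; ∃-syntax; _,_; proj₂)
open import Data.Sum using (inj₁; inj₂)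
open import Data.Empty using (⊥-elim)
open import Function.Bundles using (mk⇔)
open import Relation.Nullary using (¬_; Dec; yes; no; ¬?; map′)
open import Relation.Nullary.Decidable using (from-yes)
open import Relation.Binary using (tri<; tri≈; tri>)
open import Relation.Binary.PropositionalEquality using (refl; sym; trans; cong; cong₂; subst; module ≡-Reasoning)
open import Algebra.Properties.Monoid.Sum ℤ.+-0-monoid using (sum; sum-cong-≗)

eval-+ₚ : ∀ p q t → eval (p +ₚ q) t ≡ eval p t + eval q t
eval-+ₚ []      q       t = sym (ℤ.+-identityˡ _)
eval-+ₚ (a ∷ p) []      t = sym (ℤ.+-identityʳ _)
eval-+ₚ (a ∷ p) (b ∷ q) t rewrite eval-+ₚ p q t = regroup a b t (eval p t) (eval q t)
  where
  regroup : ∀ a b t x y → a + b + t * (x + y) ≡ a + t * x + (b + t * y)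
  regroup = solve-∀

eval-·ₚ : ∀ c p t → eval (c ·ₚ p) t ≡ c * eval p t
eval-·ₚ c []      t = sym (ℤ.*-zeroʳ c)
eval-·ₚ c (a ∷ p) t rewrite eval-·ₚ c p t = distrib c a t (eval p t)
  where
  distrib : ∀ c a t x → c * a + t * (c * x) ≡ c * (a + t * x)
  distrib = solve-∀

eval-*ₚ : ∀ p q t → eval (p *ₚ q) t ≡ eval p t * eval q t
eval-*ₚ []      q t = refl
eval-*ₚ (a ∷ p) q t
  rewrite eval-+ₚ (a ·ₚ q) (+ 0 ∷ (p *ₚ q)) t | eval-·ₚ a q t | eval-*ₚ p q t
  = distrib a t (eval p t) (eval q t)
  where
  distrib : ∀ a t x y → a * y + (+ 0 + t * (x * y)) ≡ (a + t * x) * y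
  distrib = solve-∀

eval-++-zeros : ∀ p n t → eval (p ++ replicate n (+ 0)) t ≡ eval p t
eval-++-zeros []      zero    t = refl
eval-++-zeros []      (suc n) t rewrite eval-++-zeros [] n t = cong (_+_ (+ 0)) (ℤ.*-zeroʳ t)
eval-++-zeros (a ∷ p) n       t = cong (λ x → a + t * x) (eval-++-zeros p n t)

sumₚ : (k : ℕ) → (Fin k → Poly) → Poly
sumₚ zero    f = []
sumₚ (suc k) f = f fzero +ₚ sumₚ k (λ j → f (fsuc j))

eval-sumₚ : ∀ k f t → eval (sumₚ k f) t ≡ sum (λ i → eval (f i) t)
eval-sumₚ zero    f t = refl
eval-sumₚ (suc k) f t = begin
  eval (f fzero +ₚ sumₚ k (λ j → f (fsuc j))) t
    ≡⟨ eval-+ₚ (f fzero) _ t ⟩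
  eval (f fzero) t + eval (sumₚ k (λ j → f (fsuc j))) t
    ≡⟨ cong (_+_ (eval (f fzero) t)) (eval-sumₚ k _ t) ⟩
  sum (λ i → eval (f i) t) ∎
  where open ≡-Reasoning

detₚ : (n : ℕ) → (Fin n → Fin n → Poly) → Poly
detₚ zero    M = + 1 ∷ []
detₚ (suc n) M = sumₚ (suc n) λ i →
  sgn (toℕ i) ·ₚ (M i fzero *ₚ detₚ n (λ r c → M (punchIn i r) (fsuc c)))

-- `det` recurses through a helper local to its definition, so its Laplace expansion
-- holds by `refl` only at each fixed size; det₁₀-evaluates supplies it up to 10.
LaplaceExpansion : ℕ → Set
LaplaceExpansion n = ∀ M → det (suc n) M ≡
  sum (λ i → sgn (toℕ i) * M i fzero * det n (λ r c → M (punchIn i r) (fsuc c)))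

DetEvaluates : ℕ → Set
DetEvaluates n = ∀ (M : Fin n → Fin n → Poly) (N : Fin n → Fin n → ℤ) t →
  (∀ r c → N r c ≡ eval (M r c) t) → det n N ≡ eval (detₚ n M) t

det₀-evaluates : DetEvaluates 0
det₀-evaluates M N t _ = cong (_+_ (+ 1)) (sym (ℤ.*-zeroʳ t))

det-evaluates-suc : ∀ n → LaplaceExpansion n → DetEvaluates n → DetEvaluates (suc n)
det-evaluates-suc n expand ih M N t N≡M = begin
  det (suc n) N                                           ≡⟨ expand N ⟩
  sum (λ i → sgn (toℕ i) * N i fzero * det n (minor N i)) ≡⟨ sum-cong-≗ term-evaluates ⟩
  sum (λ i → eval (term i) t)                             ≡⟨ eval-sumₚ (suc n) term t ⟨
  eval (detₚ (suc n) M) t                                 ∎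
  where
  open ≡-Reasoning
  minor : ∀ {A : Set} → (Fin (suc n) → Fin (suc n) → A) → Fin (suc n) → Fin n → Fin n → A
  minor K i r c = K (punchIn i r) (fsuc c)
  term : Fin (suc n) → Poly
  term i = sgn (toℕ i) ·ₚ (M i fzero *ₚ detₚ n (minor M i))
  term-evaluates : ∀ i → sgn (toℕ i) * N i fzero * det n (minor N i) ≡ eval (term i) t
  term-evaluates i = begin
    sgn (toℕ i) * N i fzero * det n (minor N i)
      ≡⟨ cong₂ (λ x y → sgn (toℕ i) * x * y) (N≡M i fzero)
               (ih (minor M i) (minor N i) t (λ r c → N≡M (punchIn i r) (fsuc c))) ⟩
    sgn (toℕ i) * eval (M i fzero) t * eval (detₚ n (minor M i)) t
      ≡⟨ ℤ.*-assoc (sgn (toℕ i)) _ _ ⟩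
    sgn (toℕ i) * (eval (M i fzero) t * eval (detₚ n (minor M i)) t)
      ≡⟨ cong (sgn (toℕ i) *_) (eval-*ₚ (M i fzero) _ t) ⟨
    sgn (toℕ i) * eval (M i fzero *ₚ detₚ n (minor M i)) t
      ≡⟨ eval-·ₚ (sgn (toℕ i)) (M i fzero *ₚ detₚ n (minor M i)) t ⟨
    eval (term i) t ∎

sylvesterₚ : (m n : ℕ) → (ℕ → Poly) → (ℕ → Poly) → ℕ → ℕ → Poly
sylvesterₚ m n a b i j =
  if i <ᵇ n
  then (if (i ≤ᵇ j) ∧ (j ∸ i ≤ᵇ m) then a (m ∸ (j ∸ i)) else [])
  else (if ((i ∸ n) ≤ᵇ j) ∧ (j ∸ (i ∸ n) ≤ᵇ n) then b (n ∸ (j ∸ (i ∸ n))) else [])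

resultantₚ : (m n : ℕ) → (ℕ → Poly) → (ℕ → Poly) → Poly
resultantₚ m n a b = detₚ (m ℕ.+ n) (λ r c → sylvesterₚ m n a b (toℕ r) (toℕ c))

sylEntry-evaluates : ∀ m n a b aₚ bₚ t →
  (∀ k → a k ≡ eval (aₚ k) t) → (∀ k → b k ≡ eval (bₚ k) t) →
  ∀ i j → sylEntry m n a b i j ≡ eval (sylvesterₚ m n aₚ bₚ i j) t
sylEntry-evaluates m n a b aₚ bₚ t a≡ b≡ i j with i <ᵇ n
... | true with (i ≤ᵇ j) ∧ (j ∸ i ≤ᵇ m)
...   | true  = a≡ _
...   | false = refl
sylEntry-evaluates m n a b aₚ bₚ t a≡ b≡ i j | false with ((i ∸ n) ≤ᵇ j) ∧ (j ∸ (i ∸ n) ≤ᵇ n)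
...   | true  = b≡ _
...   | false = refl

resultant-evaluates : ∀ m n a b aₚ bₚ t → DetEvaluates (m ℕ.+ n) →
  (∀ k → a k ≡ eval (aₚ k) t) → (∀ k → b k ≡ eval (bₚ k) t) →
  resultant m n a b ≡ eval (resultantₚ m n aₚ bₚ) t
resultant-evaluates m n a b aₚ bₚ t det-evaluates a≡ b≡ =
  det-evaluates _ _ t λ r c → sylEntry-evaluates m n a b aₚ bₚ t a≡ b≡ (toℕ r) (toℕ c)

-- polynomials in x with coefficients in ℤ[t]
Poly₂ : Set
Poly₂ = List Poly

coeff₂ : Poly₂ → ℕ → Poly
coeff₂ []      _       = []
coeff₂ (a ∷ _) zero    = a
coeff₂ (_ ∷ H) (suc k) = coeff₂ H k

_Specialises-to_at_ : Poly₂ → Poly → ℤ → Set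
H Specialises-to c at t = ∀ k → coeff c k ≡ eval (coeff₂ H k) t

∂X₂ : Poly₂ → ℕ → Poly
∂X₂ H j = + suc j ·ₚ coeff₂ H (suc j)

∂Z₂ : ℕ → Poly₂ → ℕ → Poly
∂Z₂ n H j = + (n ∸ j) ·ₚ coeff₂ H j

discNumeratorₚ : (n : ℕ) → Poly₂ → Poly
discNumeratorₚ n H = sgn ⌊ n ℕ.* (n ∸ 1) /2⌋ ·ₚ resultantₚ (n ∸ 1) (n ∸ 1) (∂X₂ H) (∂Z₂ n H)

discForm-specialise : ∀ n .{{_ : ℕ.NonZero (n ℕ.^ (n ∸ 2))}} H c t →
  DetEvaluates ((n ∸ 1) ℕ.+ (n ∸ 1)) → H Specialises-to c at t →
  discForm n c ≡ eval (discNumeratorₚ n H) t / (n ℕ.^ (n ∸ 2))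
discForm-specialise n H c t det-evaluates c≡H = cong (_/ (n ℕ.^ (n ∸ 2))) (begin
  sgn ⌊ n ℕ.* (n ∸ 1) /2⌋ * resultant (n ∸ 1) (n ∸ 1) (∂X c) (∂Z n c)
    ≡⟨ cong (_*_ (sgn ⌊ n ℕ.* (n ∸ 1) /2⌋))
         (resultant-evaluates (n ∸ 1) (n ∸ 1) _ _ (∂X₂ H) (∂Z₂ n H) t det-evaluates ∂X≡ ∂Z≡) ⟩
  sgn ⌊ n ℕ.* (n ∸ 1) /2⌋ * eval (resultantₚ (n ∸ 1) (n ∸ 1) (∂X₂ H) (∂Z₂ n H)) t
    ≡⟨ eval-·ₚ _ (resultantₚ (n ∸ 1) (n ∸ 1) (∂X₂ H) (∂Z₂ n H)) t ⟨
  eval (discNumeratorₚ n H) t ∎)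
  where
  open ≡-Reasoning
  ∂X≡ : ∀ k → ∂X c k ≡ eval (∂X₂ H k) t
  ∂X≡ k = trans (cong (_*_ (+ suc k)) (c≡H (suc k))) (sym (eval-·ₚ _ (coeff₂ H (suc k)) t))
  ∂Z≡ : ∀ k → ∂Z n c k ≡ eval (∂Z₂ n H k) t
  ∂Z≡ k = trans (cong (_*_ (+ (n ∸ k))) (c≡H k)) (sym (eval-·ₚ _ (coeff₂ H k) t))

/-*-/-cancel : ∀ e m n .{{_ : ℕ.NonZero m}} .{{_ : ℕ.NonZero n}} →
  (e * + (m ℕ.* n)) / m ℚ.* (+ 1 / n) ≡ toℚ e
/-*-/-cancel e (suc m) (suc n) = ℚ.toℚᵘ-injective (begin
  ℚ.toℚᵘ (e * + (suc m ℕ.* suc n) / suc m ℚ.* (+ 1 / suc n))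
    ≈⟨ ℚ.toℚᵘ-homo-* (e * + (suc m ℕ.* suc n) / suc m) (+ 1 / suc n) ⟩
  ℚ.toℚᵘ (e * + (suc m ℕ.* suc n) / suc m) ℚᵘ.* ℚ.toℚᵘ (+ 1 / suc n)
    ≈⟨ ℚᵘ.*-cong (ℚ.toℚᵘ-fromℚᵘ (mkℚᵘ (e * + (suc m ℕ.* suc n)) m)) (ℚ.toℚᵘ-fromℚᵘ (mkℚᵘ (+ 1) n)) ⟩
  mkℚᵘ (e * + (suc m ℕ.* suc n)) m ℚᵘ.* mkℚᵘ (+ 1) n
    ≈⟨ *≡* (cross-multiplied e (+ (suc m ℕ.* suc n))) ⟩
  mkℚᵘ e 0
    ≈⟨ ℚ.toℚᵘ-fromℚᵘ (mkℚᵘ e 0) ⟨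
  ℚ.toℚᵘ (toℚ e) ∎)
  where
  open ℚᵘ.≃-Reasoning
  cross-multiplied : ∀ e d → e * d * + 1 * + 1 ≡ e * d
  cross-multiplied = solve-∀

det₁₀-evaluates : DetEvaluates 10
det₁₀-evaluates =
  det-evaluates-suc 9 (λ _ → refl) (det-evaluates-suc 8 (λ _ → refl) (det-evaluates-suc 7 (λ _ → refl)
  (det-evaluates-suc 6 (λ _ → refl) (det-evaluates-suc 5 (λ _ → refl) (det-evaluates-suc 4 (λ _ → refl)
  (det-evaluates-suc 3 (λ _ → refl) (det-evaluates-suc 2 (λ _ → refl) (det-evaluates-suc 1 (λ _ → refl)
  (det-evaluates-suc 0 (λ _ → refl) det₀-evaluates)))))))))

sextic : Weierstrass → Poly
sextic (weq Q P) = + 4 ·ₚ P +ₚ Q *ₚ Q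

Δ-specialise : ∀ W H D t → H Specialises-to sextic W at t →
  discNumeratorₚ 6 H ≡ + (6 ℕ.^ 4 ℕ.* 2 ℕ.^ 12) ·ₚ D → Δ W ≡ toℚ (eval D t)
Δ-specialise W@(weq Q P) H D t spec disc≡ = begin
  discForm 6 (sextic W) ℚ.* (+ 1 / 2 ℕ.^ 12)
    ≡⟨ cong (ℚ._* (+ 1 / 2 ℕ.^ 12)) (discForm-specialise 6 H (sextic W) t det₁₀-evaluates spec) ⟩
  eval (discNumeratorₚ 6 H) t / 6 ℕ.^ 4 ℚ.* (+ 1 / 2 ℕ.^ 12)
    ≡⟨ cong (λ z → z / 6 ℕ.^ 4 ℚ.* (+ 1 / 2 ℕ.^ 12)) numerator≡ ⟩
  eval D t * + (6 ℕ.^ 4 ℕ.* 2 ℕ.^ 12) / 6 ℕ.^ 4 ℚ.* (+ 1 / 2 ℕ.^ 12)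
    ≡⟨ /-*-/-cancel (eval D t) (6 ℕ.^ 4) (2 ℕ.^ 12) ⟩
  toℚ (eval D t) ∎
  where
  open ≡-Reasoning
  numerator≡ : eval (discNumeratorₚ 6 H) t ≡ eval D t * + (6 ℕ.^ 4 ℕ.* 2 ℕ.^ 12)
  numerator≡ = trans (cong (λ p → eval p t) disc≡)
    (trans (eval-·ₚ _ D t) (ℤ.*-comm (+ (6 ℕ.^ 4 ℕ.* 2 ℕ.^ 12)) (eval D t)))

sextic-E : Poly₂
sextic-E = [] ∷ (+ 4 ∷ []) ∷ (+ 32 ∷ + 4 ∷ []) ∷ (+ 64 ∷ + 32 ∷ []) ∷ (+ 1 ∷ + 64 ∷ []) ∷ (+ 4 ∷ []) ∷ []

sextic-F : Poly₂
sextic-F = [] ∷ (- + 4 ∷ []) ∷ (+ 9 ∷ + 4 ∷ []) ∷ (- + 6 ∷ - + 8 ∷ []) ∷ (- + 3 ∷ + 4 ∷ []) ∷ (+ 4 ∷ []) ∷ []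

sextic-E-specialises : ∀ t → sextic-E Specialises-to sextic (E t) at t
sextic-E-specialises t 0 = refl
sextic-E-specialises t 1 = x¹ t
  where
  x¹ : ∀ t → + 4 ≡ + 4 + t * + 0
  x¹ = solve-∀
sextic-E-specialises t 2 = x² t
  where
  x² : ∀ t → + 4 * (+ 8 + t) + + 0 ≡ + 32 + t * (+ 4 + t * + 0)
  x² = solve-∀
sextic-E-specialises t 3 = x³ t
  where
  x³ : ∀ t → + 4 * (+ 16 + + 8 * t) + + 0 ≡ + 64 + t * (+ 32 + t * + 0)
  x³ = solve-∀
sextic-E-specialises t 4 = x⁴ t
  where
  x⁴ : ∀ t → + 4 * (+ 16 * t) + + 1 ≡ + 1 + t * (+ 64 + t * + 0)
  x⁴ = solve-∀
sextic-E-specialises t 5 = x⁵ t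
  where
  x⁵ : ∀ t → + 4 ≡ + 4 + t * + 0
  x⁵ = solve-∀
sextic-E-specialises t (suc (suc (suc (suc (suc (suc k)))))) = refl

sextic-F-specialises : ∀ t → sextic-F Specialises-to sextic (F t) at t
sextic-F-specialises t 0 = refl
sextic-F-specialises t 1 = x¹ t
  where
  x¹ : ∀ t → - + 4 ≡ - + 4 + t * + 0
  x¹ = solve-∀
sextic-F-specialises t 2 = x² t
  where
  x² : ∀ t → + 4 * (+ 2 + t) + + 1 ≡ + 9 + t * (+ 4 + t * + 0)
  x² = solve-∀
sextic-F-specialises t 3 = x³ t
  where
  x³ : ∀ t → + 4 * (- + 2 + - + 2 * t) + + 2 ≡ - + 6 + t * (- + 8 + t * + 0)
  x³ = solve-∀
sextic-F-specialises t 4 = x⁴ t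
  where
  x⁴ : ∀ t → + 4 * (- + 1 + t) + + 1 ≡ - + 3 + t * (+ 4 + t * + 0)
  x⁴ = solve-∀
sextic-F-specialises t 5 = x⁵ t
  where
  x⁵ : ∀ t → + 4 ≡ + 4 + t * + 0
  x⁵ = solve-∀
sextic-F-specialises t (suc (suc (suc (suc (suc (suc k)))))) = refl

-- the expansion over ℤ[t] carries three trailing zero coefficients
discNumerator-E : discNumeratorₚ 6 sextic-E ≡ + (6 ℕ.^ 4 ℕ.* 2 ℕ.^ 12) ·ₚ (f ++ replicate 3 (+ 0))
discNumerator-E = refl

discNumerator-F : discNumeratorₚ 6 sextic-F ≡ + (6 ℕ.^ 4 ℕ.* 2 ℕ.^ 12) ·ₚ (g ++ replicate 3 (+ 0))
discNumerator-F = refl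

Δ-E : ∀ t → Δ (E t) ≡ toℚ (eval f t)
Δ-E t = trans (Δ-specialise (E t) sextic-E (f ++ replicate 3 (+ 0)) t (sextic-E-specialises t) discNumerator-E)
              (cong toℚ (eval-++-zeros f 3 t))

Δ-F : ∀ t → Δ (F t) ≡ toℚ (eval g t)
Δ-F t = trans (Δ-specialise (F t) sextic-F (g ++ replicate 3 (+ 0)) t (sextic-F-specialises t) discNumerator-F)
              (cong toℚ (eval-++-zeros g 3 t))

coeff-+ₚ : ∀ p q k → coeff (p +ₚ q) k ≡ coeff p k + coeff q k
coeff-+ₚ []      q       k       = sym (ℤ.+-identityˡ _)
coeff-+ₚ (a ∷ p) []      k       = sym (ℤ.+-identityʳ _)
coeff-+ₚ (a ∷ p) (b ∷ q) zero    = refl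
coeff-+ₚ (a ∷ p) (b ∷ q) (suc k) = coeff-+ₚ p q k

coeff-·ₚ : ∀ c p k → coeff (c ·ₚ p) k ≡ c * coeff p k
coeff-·ₚ c []      k       = sym (ℤ.*-zeroʳ c)
coeff-·ₚ c (a ∷ p) zero    = refl
coeff-·ₚ c (a ∷ p) (suc k) = coeff-·ₚ c p k

-- convolution k u v = Σ_{i ≤ k} u i · v (k − i)
convolution : ℕ → (ℕ → ℤ) → (ℕ → ℤ) → ℤ
convolution zero    u v = u 0 * v 0
convolution (suc k) u v = u 0 * v (suc k) + convolution k (λ i → u (suc i)) v

convolution-zeroˡ : ∀ k u v → (∀ i → u i ≡ + 0) → convolution k u v ≡ + 0
convolution-zeroˡ zero    u v u≡0 rewrite u≡0 0 = refl
convolution-zeroˡ (suc k) u v u≡0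
  rewrite u≡0 0 | convolution-zeroˡ k (λ i → u (suc i)) v (λ i → u≡0 (suc i)) = refl

convolution-zeroʳ : ∀ k u v → (∀ i → v i ≡ + 0) → convolution k u v ≡ + 0
convolution-zeroʳ zero    u v v≡0 rewrite v≡0 0 = ℤ.*-zeroʳ (u 0)
convolution-zeroʳ (suc k) u v v≡0
  rewrite v≡0 (suc k) | convolution-zeroʳ k (λ i → u (suc i)) v v≡0 | ℤ.*-zeroʳ (u 0) = refl

coeff-*ₚ : ∀ a b k → coeff (a *ₚ b) k ≡ convolution k (coeff a) (coeff b)
coeff-*ₚ []      b k       = sym (convolution-zeroˡ k (coeff []) (coeff b) (λ _ → refl))
coeff-*ₚ (x ∷ p) b zero    = begin
  coeff (x ·ₚ b +ₚ (+ 0 ∷ (p *ₚ b))) 0 ≡⟨ coeff-+ₚ (x ·ₚ b) (+ 0 ∷ (p *ₚ b)) 0 ⟩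
  coeff (x ·ₚ b) 0 + + 0              ≡⟨ ℤ.+-identityʳ _ ⟩
  coeff (x ·ₚ b) 0                    ≡⟨ coeff-·ₚ x b 0 ⟩
  x * coeff b 0                       ∎
  where open ≡-Reasoning
coeff-*ₚ (x ∷ p) b (suc k) =
  trans (coeff-+ₚ (x ·ₚ b) (+ 0 ∷ (p *ₚ b)) (suc k))
    (cong₂ _+_ (coeff-·ₚ x b (suc k)) (coeff-*ₚ p b k))

VanishesAbove : (ℕ → ℤ) → ℕ → Set
VanishesAbove u d = ∀ k → d < k → u k ≡ + 0

convolution-constˡ : ∀ k u v → VanishesAbove u 0 → convolution k u v ≡ u 0 * v k
convolution-constˡ zero    u v _  = refl
convolution-constˡ (suc k) u v u↑
  rewrite convolution-zeroˡ k (λ i → u (suc i)) v (λ i → u↑ (suc i) (s≤s z≤n)) = ℤ.+-identityʳ _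

convolution-constʳ : ∀ k u v → VanishesAbove v 0 → convolution k u v ≡ u k * v 0
convolution-constʳ zero    u v _ = refl
convolution-constʳ (suc k) u v v↑
  rewrite v↑ (suc k) (s≤s z≤n) | convolution-constʳ k (λ i → u (suc i)) v v↑ | ℤ.*-zeroʳ (u 0)
  = ℤ.+-identityˡ _

convolution-top : ∀ da db u v → VanishesAbove u da → VanishesAbove v db →
  convolution (da ℕ.+ db) u v ≡ u da * v db
convolution-top zero     db u v u↑ v↑ = convolution-constˡ db u v u↑
convolution-top (suc da) db u v u↑ v↑
  rewrite v↑ (suc (da ℕ.+ db)) (s≤s (ℕ.m≤n+m db da))
        | convolution-top da db (λ i → u (suc i)) v (λ k p → u↑ (suc k) (s≤s p)) v↑
        | ℤ.*-zeroʳ (u 0)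
  = ℤ.+-identityˡ _

convolution-beyond : ∀ da db u v → VanishesAbove u da → VanishesAbove v db →
  VanishesAbove (λ k → convolution k u v) (da ℕ.+ db)
convolution-beyond zero db u v u↑ v↑ k db<k = begin
  convolution k u v ≡⟨ convolution-constˡ k u v u↑ ⟩
  u 0 * v k         ≡⟨ cong (u 0 *_) (v↑ k db<k) ⟩
  u 0 * + 0         ≡⟨ ℤ.*-zeroʳ (u 0) ⟩
  + 0               ∎
  where open ≡-Reasoning
convolution-beyond (suc da) db u v u↑ v↑ (suc k) (s≤s da+db<k)
  rewrite v↑ (suc k) (s≤s (ℕ.≤-trans (ℕ.m≤n+m db da) (ℕ.<⇒≤ da+db<k)))
        | convolution-beyond da db (λ i → u (suc i)) v (λ j p → u↑ (suc j) (s≤s p)) v↑ k da+db<k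
        | ℤ.*-zeroʳ (u 0)
  = refl

coeff-beyond-length : ∀ p k → length p ℕ.≤ k → coeff p k ≡ + 0
coeff-beyond-length []      k       _           = refl
coeff-beyond-length (a ∷ p) (suc k) (s≤s len≤k) = coeff-beyond-length p k len≤k

zero-or-degree : ∀ a → (∀ k → coeff a k ≡ + 0) ⊎ ∃[ d ] HasDegree a d
zero-or-degree []      = inj₁ λ _ → refl
zero-or-degree (x ∷ p) with zero-or-degree p
... | inj₂ (d , a_d≢0 , p↑) = inj₂ (suc d , a_d≢0 , λ { zero () ; (suc k) (s≤s d<k) → p↑ k d<k })
... | inj₁ p≡0 with x ℤ.≟ + 0
...   | yes x≡0 = inj₁ λ { zero → x≡0 ; (suc k) → p≡0 k }
...   | no  x≢0 = inj₂ (0 , x≢0 , λ { zero () ; (suc k) _ → p≡0 k })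

degree-of-product : ∀ a b c {n da db} → (a *ₚ b) ≈ₚ c → HasDegree c n →
  HasDegree a da → HasDegree b db → da ℕ.+ db ≡ n
degree-of-product a b c {n} {da} {db} ab≈c (c_n≢0 , c↑) (a_da≢0 , a↑) (b_db≢0 , b↑)
  with ℕ.<-cmp (da ℕ.+ db) n
... | tri≈ _ eq _ = eq
... | tri< lt _ _ = ⊥-elim (c_n≢0 (begin
  coeff c n                            ≡⟨ sym (ab≈c n) ⟩
  coeff (a *ₚ b) n                     ≡⟨ coeff-*ₚ a b n ⟩
  convolution n (coeff a) (coeff b)    ≡⟨ convolution-beyond da db _ _ a↑ b↑ n lt ⟩
  + 0                                  ∎))
  where open ≡-Reasoning
... | tri> _ _ gt with ℤ.i*j≡0⇒i≡0∨j≡0 (coeff a da) (begin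
  coeff a da * coeff b db                        ≡⟨ sym (convolution-top da db _ _ a↑ b↑) ⟩
  convolution (da ℕ.+ db) (coeff a) (coeff b)    ≡⟨ sym (coeff-*ₚ a b (da ℕ.+ db)) ⟩
  coeff (a *ₚ b) (da ℕ.+ db)                     ≡⟨ ab≈c (da ℕ.+ db) ⟩
  coeff c (da ℕ.+ db)                            ≡⟨ c↑ (da ℕ.+ db) gt ⟩
  + 0                                            ∎)
  where open ≡-Reasoning
...   | inj₁ a_da≡0 = ⊥-elim (a_da≢0 a_da≡0)
...   | inj₂ b_db≡0 = ⊥-elim (b_db≢0 b_db≡0)

*≡1⇒≡±1 : ∀ x w → x * w ≡ + 1 → x ≡ + 1 ⊎ x ≡ -[1+ 0 ]
*≡1⇒≡±1 x w xw≡1 with x | ℕ.m*n≡1⇒m≡1 ℤ.∣ x ∣ ℤ.∣ w ∣ (trans (sym (ℤ.abs-* x w)) (cong ℤ.∣_∣ xw≡1))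
... | + _      | refl = inj₁ refl
... | -[1+ _ ] | refl = inj₂ refl

common-factor-of-coprime≡±1 : ∀ u (v c : ℕ → ℤ) n x y → (∀ k → c k ≡ u * v k) →
  c 0 * x + c n * y ≡ + 1 → u ≡ + 1 ⊎ u ≡ -[1+ 0 ]
common-factor-of-coprime≡±1 u v c n x y c≡uv bézout = *≡1⇒≡±1 u (v 0 * x + v n * y) (begin
  u * (v 0 * x + v n * y)       ≡⟨ distrib u (v 0) (v n) x y ⟩
  u * v 0 * x + u * v n * y     ≡⟨ cong₂ (λ p q → p * x + q * y) (sym (c≡uv 0)) (sym (c≡uv n)) ⟩
  c 0 * x + c n * y             ≡⟨ bézout ⟩
  + 1                           ∎)
  where
  open ≡-Reasoning
  distrib : ∀ u p q x y → u * (p * x + q * y) ≡ u * p * x + u * q * y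
  distrib = solve-∀

constant-IsUnitₚ : ∀ a → VanishesAbove (coeff a) 0 → coeff a 0 ≡ + 1 ⊎ coeff a 0 ≡ -[1+ 0 ] → IsUnitₚ a
constant-IsUnitₚ a a↑ (inj₁ a₀≡1)  = inj₁ λ { zero → a₀≡1  ; (suc k) → a↑ (suc k) (s≤s z≤n) }
constant-IsUnitₚ a a↑ (inj₂ a₀≡-1) = inj₂ λ { zero → a₀≡-1 ; (suc k) → a↑ (suc k) (s≤s z≤n) }

constant-factorˡ-IsUnitₚ : ∀ a b c n x y → (a *ₚ b) ≈ₚ c → coeff c 0 * x + coeff c n * y ≡ + 1 →
  VanishesAbove (coeff a) 0 → IsUnitₚ a
constant-factorˡ-IsUnitₚ a b c n x y ab≈c bézout a↑ =
  constant-IsUnitₚ a a↑ (common-factor-of-coprime≡±1 (coeff a 0) (coeff b) (coeff c) n x y c≡a₀b bézout)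
  where
  c≡a₀b : ∀ k → coeff c k ≡ coeff a 0 * coeff b k
  c≡a₀b k = trans (sym (ab≈c k)) (trans (coeff-*ₚ a b k) (convolution-constˡ k _ _ a↑))

constant-factorʳ-IsUnitₚ : ∀ a b c n x y → (a *ₚ b) ≈ₚ c → coeff c 0 * x + coeff c n * y ≡ + 1 →
  VanishesAbove (coeff b) 0 → IsUnitₚ b
constant-factorʳ-IsUnitₚ a b c n x y ab≈c bézout b↑ =
  constant-IsUnitₚ b b↑ (common-factor-of-coprime≡±1 (coeff b 0) (coeff a) (coeff c) n x y c≡b₀a bézout)
  where
  c≡b₀a : ∀ k → coeff c k ≡ coeff b 0 * coeff a k
  c≡b₀a k = trans (sym (ab≈c k))
    (trans (coeff-*ₚ a b k) (trans (convolution-constʳ k _ _ b↑) (ℤ.*-comm (coeff a k) (coeff b 0))))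

∣-+-cong : ∀ {m} x X y Y → m ∣ x - X → m ∣ y - Y → m ∣ (x + y) - (X + Y)
∣-+-cong {m} x X y Y m∣x-X m∣y-Y =
  subst (m ∣_) (regroup x X y Y) (∣m∣n⇒∣m+n m∣x-X m∣y-Y)
  where
  regroup : ∀ x X y Y → (x - X) + (y - Y) ≡ (x + y) - (X + Y)
  regroup = solve-∀

∣-*-cong : ∀ {m} x X y Y → m ∣ x - X → m ∣ y - Y → m ∣ x * y - X * Y
∣-*-cong {m} x X y Y m∣x-X m∣y-Y =
  subst (m ∣_) (regroup x X y Y) (∣m∣n⇒∣m+n (∣n⇒∣m*n x m∣y-Y) (∣m⇒∣m*n Y m∣x-X))
  where
  regroup : ∀ x X y Y → x * (y - Y) + (x - X) * Y ≡ x * y - X * Y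
  regroup = solve-∀

convolution-mod : ∀ {m} k u v U V → (∀ i → m ∣ u i - U i) → (∀ i → m ∣ v i - V i) →
  m ∣ convolution k u v - convolution k U V
convolution-mod zero    u v U V u≡U v≡V = ∣-*-cong (u 0) (U 0) (v 0) (V 0) (u≡U 0) (v≡V 0)
convolution-mod (suc k) u v U V u≡U v≡V =
  ∣-+-cong (u 0 * v (suc k)) (U 0 * V (suc k))
    (convolution k (λ i → u (suc i)) v) (convolution k (λ i → U (suc i)) V)
    (∣-*-cong (u 0) (U 0) (v (suc k)) (V (suc k)) (u≡U 0) (v≡V (suc k)))
    (convolution-mod k (λ i → u (suc i)) v (λ i → U (suc i)) V (λ i → u≡U (suc i)) v≡V)

all-Vec? : ∀ {n k} {P : Vec (Fin n) k → Set} → (∀ v → Dec (P v)) → Dec (∀ v → P v)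
all-Vec? {k = zero}  P? = map′ (λ p → λ { [] → p }) (λ ∀P → ∀P []) (P? [])
all-Vec? {k = suc k} P? = map′ (λ ∀P → λ { (x ∷ v) → ∀P x v }) (λ ∀P x v → ∀P (x ∷ v))
  (Fin.all? λ x → all-Vec? λ v → P? (x ∷ v))

module _ (q : ℕ) .{{_ : ℕ.NonZero q}} where

  residuePoly : ∀ {k} → Vec (Fin q) k → Poly
  residuePoly []       = []
  residuePoly (r ∷ rs) = + toℕ r ∷ residuePoly rs

  residue : ∀ x → Σ (Fin q) λ r → + q ∣ x - + toℕ r
  residue x = fromℕ< (ℤ.n%ℕd<d x q) , divides (x ℤ./ℕ q) (begin
    x - + toℕ (fromℕ< (ℤ.n%ℕd<d x q)) ≡⟨ cong (λ r → x - + r) (Fin.toℕ-fromℕ< (ℤ.n%ℕd<d x q)) ⟩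
    x - + (x ℤ.%ℕ q)                  ≡⟨ cong (_- + (x ℤ.%ℕ q)) (ℤ.a≡a%ℕn+[a/ℕn]*n x q) ⟩
    + (x ℤ.%ℕ q) + (x ℤ./ℕ q) * + q - + (x ℤ.%ℕ q) ≡⟨ cancel (+ (x ℤ.%ℕ q)) _ ⟩
    (x ℤ./ℕ q) * + q                  ∎)
    where
    open ≡-Reasoning
    cancel : ∀ r s → r + s - r ≡ s
    cancel = solve-∀

  reduce-mod : ∀ d u → VanishesAbove u d →
    Σ (Vec (Fin q) (suc d)) λ U → ∀ i → + q ∣ u i - coeff (residuePoly U) i
  reduce-mod d u u↑ with residue (u 0)
  reduce-mod zero    u u↑ | r , u₀≡r = r ∷ [] , λ { zero → u₀≡r ; (suc i) → vanishing (u↑ (suc i) (s≤s z≤n)) }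
    where
    vanishing : ∀ {x} → x ≡ + 0 → + q ∣ x - + 0
    vanishing refl = divides (+ 0) refl
  reduce-mod (suc d) u u↑ | r , u₀≡r with reduce-mod d (λ i → u (suc i)) (λ k d<k → u↑ (suc k) (s≤s d<k))
  ... | U , u≡U = r ∷ U , λ { zero → u₀≡r ; (suc i) → u≡U i }

  FactorsMod : ℕ → ℕ → Poly → Set
  FactorsMod da db c = Σ (Vec (Fin q) (suc da)) λ U → Σ (Vec (Fin q) (suc db)) λ V →
    ∀ {k} → k < suc (da ℕ.+ db) →
      + q ∣ coeff c k - convolution k (coeff (residuePoly U)) (coeff (residuePoly V))

  ¬FactorsMod? : ∀ da db c → Dec (¬ FactorsMod da db c)
  ¬FactorsMod? da db c = map′ (λ ∀U∀V (U , V , UV≡c) → ∀U∀V U V (λ {k} → UV≡c {k}))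
    (λ ¬∃ U V UV≡c → ¬∃ (U , V , λ {k} → UV≡c {k}))
    (all-Vec? λ U → all-Vec? λ V → ¬? (ℕ.allUpTo? (congruent? U V) (suc (da ℕ.+ db))))
    where
    congruent? : ∀ (U : Vec (Fin q) (suc da)) (V : Vec (Fin q) (suc db)) k → Dec (+ q ∣ coeff c k - convolution k (coeff (residuePoly U)) (coeff (residuePoly V)))
    congruent? U V k = + q ∣? coeff c k - convolution k (coeff (residuePoly U)) (coeff (residuePoly V))

  factors-mod : ∀ a b c {da db} → (a *ₚ b) ≈ₚ c →
    VanishesAbove (coeff a) da → VanishesAbove (coeff b) db → FactorsMod da db c
  factors-mod a b c {da} {db} ab≈c a↑ b↑ with reduce-mod da (coeff a) a↑ | reduce-mod db (coeff b) b↑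
  ... | U , a≡U | V , b≡V = U , V , λ {k} _ →
    subst (λ x → + q ∣ x - _) (trans (sym (coeff-*ₚ a b k)) (ab≈c k))
      (convolution-mod k _ _ _ _ a≡U b≡V)

irreducible-by-reduction : ∀ c n q .{{_ : ℕ.NonZero q}} x y → HasDegree c (suc n) →
  coeff c 0 * x + coeff c (suc n) * y ≡ + 1 →
  (∀ da → 0 < da → da < suc n → ¬ FactorsMod q da (suc n ∸ da) c) → Irreducibleₚ c
irreducible-by-reduction c n q x y deg-c@(c_n≢0 , _) bézout no-factors-mod =
  (λ c≈0 → c_n≢0 (c≈0 (suc n))) ,
  (λ { (inj₁ c≈1) → c_n≢0 (c≈1 (suc n)) ; (inj₂ c≈-1) → c_n≢0 (c≈-1 (suc n)) }) ,
  factorisation-has-unit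
  where
  factorisation-has-unit : ∀ a b → (a *ₚ b) ≈ₚ c → IsUnitₚ a ⊎ IsUnitₚ b
  factorisation-has-unit a b ab≈c with zero-or-degree a | zero-or-degree b
  ... | inj₁ a≡0 | _ = ⊥-elim (c_n≢0 (trans (sym (ab≈c (suc n)))
          (trans (coeff-*ₚ a b (suc n)) (convolution-zeroˡ (suc n) (coeff a) (coeff b) a≡0))))
  ... | inj₂ _ | inj₁ b≡0 = ⊥-elim (c_n≢0 (trans (sym (ab≈c (suc n)))
          (trans (coeff-*ₚ a b (suc n)) (convolution-zeroʳ (suc n) (coeff a) (coeff b) b≡0))))
  ... | inj₂ (da , deg-a) | inj₂ (db , deg-b) =
    split da db (degree-of-product a b c ab≈c deg-c deg-a deg-b) (proj₂ deg-a) (proj₂ deg-b)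
    where
    split : ∀ da db → da ℕ.+ db ≡ suc n → VanishesAbove (coeff a) da → VanishesAbove (coeff b) db →
      IsUnitₚ a ⊎ IsUnitₚ b
    split zero     db       _  a↑ _  = inj₁ (constant-factorˡ-IsUnitₚ a b c (suc n) x y ab≈c bézout a↑)
    split (suc i)  zero     _  _  b↑ = inj₂ (constant-factorʳ-IsUnitₚ a b c (suc n) x y ab≈c bézout b↑)
    split (suc i) (suc j) sum≡ a↑ b↑ = ⊥-elim (no-factors-mod (suc i) (s≤s z≤n) da<
      (subst (λ db → FactorsMod q (suc i) db c) (sym db≡) (factors-mod q a b c ab≈c a↑ b↑)))
      where
      da< : suc i < suc n
      da< = subst (suc i <_) sum≡ (ℕ.m<m+n (suc i) (s≤s z≤n))
      db≡ : suc n ∸ suc i ≡ suc j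
      db≡ = trans (cong (_∸ suc i) (sym sum≡)) (ℕ.m+n∸m≡n (suc i) (suc j))

degree-f : HasDegree f 4
degree-f = (λ ()) , coeff-beyond-length f

degree-g : HasDegree g 4
degree-g = (λ ()) , coeff-beyond-length g

irreducible-f : Irreducibleₚ f
irreducible-f = irreducible-by-reduction f 3 3 (- + 275) (- + 1129) degree-f refl λ
  { 1 _ _ → from-yes (¬FactorsMod? 3 1 3 f)
  ; 2 _ _ → from-yes (¬FactorsMod? 3 2 2 f)
  ; 3 _ _ → from-yes (¬FactorsMod? 3 3 1 f)
  ; (suc (suc (suc (suc _)))) _ (s≤s (s≤s (s≤s (s≤s ())))) }

irreducible-g : Irreducibleₚ g
irreducible-g = irreducible-by-reduction g 3 3 (- + 247) (- + 6120) degree-g refl λ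
  { 1 _ _ → from-yes (¬FactorsMod? 3 1 3 g)
  ; 2 _ _ → from-yes (¬FactorsMod? 3 2 2 g)
  ; 3 _ _ → from-yes (¬FactorsMod? 3 3 1 g)
  ; (suc (suc (suc (suc _)))) _ (s≤s (s≤s (s≤s (s≤s ())))) }

toℚ≡mkℚ : ∀ e → toℚ e ≡ mkℚ e 0 (coprime-sym (1-coprimeTo ℤ.∣ e ∣))
toℚ≡mkℚ e = ℚ.↥p/↧p≡p (mkℚ e 0 (coprime-sym (1-coprimeTo ℤ.∣ e ∣)))

toℚ-injective : ∀ {a b} → toℚ a ≡ toℚ b → a ≡ b
toℚ-injective {a} {b} eq = cong ℚ.↥_ (trans (sym (toℚ≡mkℚ a)) (trans eq (toℚ≡mkℚ b)))

∣toℚ∣ : ∀ e → ℚ.∣ toℚ e ∣ ≡ toℚ (+ ℤ.∣ e ∣)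
∣toℚ∣ e = trans (cong ℚ.∣_∣ (toℚ≡mkℚ e)) (sym (toℚ≡mkℚ (+ ℤ.∣ e ∣)))

∣∣≡⇔ : ∀ {D} e m → D ≡ toℚ e → (ℚ.∣ D ∣ ≡ toℚ m) ⇔ (+ ℤ.∣ e ∣ ≡ m)
∣∣≡⇔ {D} e m D≡e = mk⇔
  (λ ∣D∣≡m → toℚ-injective (trans (sym (∣toℚ∣ e)) (trans (cong ℚ.∣_∣ (sym D≡e)) ∣D∣≡m)))
  (λ ∣e∣≡m → trans (cong ℚ.∣_∣ D≡e) (trans (∣toℚ∣ e) (cong toℚ ∣e∣≡m)))

≡±⇔ : ∀ {D} e p → D ≡ toℚ e → (D ≡ toℚ (+ p) ⊎ D ≡ toℚ (- + p)) ⇔ (e ≡ + p ⊎ e ≡ - + p)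
≡±⇔ {D} e p D≡e = mk⇔
  (λ { (inj₁ D≡p) → inj₁ (toℚ-injective (trans (sym D≡e) D≡p))
     ; (inj₂ D≡-p) → inj₂ (toℚ-injective (trans (sym D≡e) D≡-p)) })
  (λ { (inj₁ e≡p) → inj₁ (trans D≡e (cong toℚ e≡p))
     ; (inj₂ e≡-p) → inj₂ (trans D≡e (cong toℚ e≡-p)) })

corollary2 :
    ((HasDegree f 4 × Irreducibleₚ f) × (HasDegree g 4 × Irreducibleₚ g))
    × (∀ (t₀ m : ℤ) → SquareFree m → Odd m →
         ((ℚ.∣ Δ (E t₀) ∣ ≡ toℚ m) ⇔ (+ ℤ.∣ eval f t₀ ∣ ≡ m))
         × ((ℚ.∣ Δ (F t₀) ∣ ≡ toℚ m) ⇔ (+ ℤ.∣ eval g t₀ ∣ ≡ m)))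
    × (∀ (t₀ : ℤ) (p : ℕ) → Prime p → p ≢ 2 →
         ((Δ (E t₀) ≡ toℚ (+ p) ⊎ Δ (E t₀) ≡ toℚ (- (+ p)))
            ⇔ (eval f t₀ ≡ + p ⊎ eval f t₀ ≡ - (+ p)))
         × ((Δ (F t₀) ≡ toℚ (+ p) ⊎ Δ (F t₀) ≡ toℚ (- (+ p)))
            ⇔ (eval g t₀ ≡ + p ⊎ eval g t₀ ≡ - (+ p))))
corollary2 =
  ((degree-f , irreducible-f) , (degree-g , irreducible-g)) ,
  (λ t₀ m _ _ → ∣∣≡⇔ (eval f t₀) m (Δ-E t₀) , ∣∣≡⇔ (eval g t₀) m (Δ-F t₀)) ,
  (λ t₀ p _ _ → ≡±⇔ (eval f t₀) p (Δ-E t₀) , ≡±⇔ (eval g t₀) p (Δ-F t₀))
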